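{- Let $G$ be a context-free grammar with ownership, $A$ a nondeterministic finite automaton over its terminals and $\sigma$ the least solution of the induced system of equations. Let $\alpha=wX\beta$ with $w\in T^*$, $X\in N$, $\beta\in(N\cup T)^*$, and assume $\sigma(\alpha)$ is not rejecting. (1) If $X\in N_\square$, there is a rule $X\to\eta$ such that $\sigma(w\eta\beta)$ is not rejecting. (2) If $X\in N_\bigcirc$, then $\sigma(w\eta\beta)$ is not rejecting for all rules $X\to\eta$.
   Context: $G=(N_{\bigcirc}\,\dot\cup\,N_{\square},T,P)$ with disjoint finite sets of non-terminals $N=N_\bigcirc\cup N_\square$ (owned by refuter and prover, respectively) and terminals $T$, finitely many rules $X\to\eta$ ($X\in N$, $\eta\in(N\cup T)^*$), every non-terminal having a rule. $A=(T,Q,q_0,Q_F,\to)$. Boxes are subsets of $Q\times Q$ with relational composition $\rho;\tau=\{(q,q''):\exists q'.(q,q')\in\rho,(q',q'')\in\tau\}$, $\mathrm{id}=\{(q,q)\}$, $[a]=\{(q,q'):q\xrightarrow{a}q'\}$. Formulas are negation-free Boolean formulas over boxes with constant $\mathit{false}$ ($\mathit{false}\wedge F=\mathit{false}$, $\mathit{false}\vee F=F$, symmetric, applied syntactically), composed by $F;\mathit{false}=\mathit{false};G=\mathit{false}$, $(F_1\star F_2);G=(F_1;G)\star(F_2;G)$, $\rho;(G_1\star G_2)=(\rho;G_1)\star(\rho;G_2)$, $\star\in\{\wedge,\vee\}$; taken modulo logical equivalence, ordered by implication. The induced system: for each $X$ with rules $X\to\eta_1,\dots,X\to\eta_k$,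 $\Delta_X=\bigwedge_j[\eta_j]$ if $X\in N_\square$, $\Delta_X=\bigvee_j[\eta_j]$ if $X\in N_\bigcirc$, with $[\varepsilon]=\mathrm{id}$, $[a]$ the box of $a$, $[Y]=\Delta_Y$, $[\alpha\beta]=[\alpha];[\beta]$. $\sigma$ is its least solution (Kleene iteration from $\mathit{false}$), extended by $\sigma(\varepsilon)=\mathrm{id}$, $\sigma(a)=[a]$, $\sigma(\alpha\beta)=\sigma(\alpha);\sigma(\beta)$. A formula is rejecting if it is true under the assignment mapping a box $\rho$ to true iff $\rho$ contains no pair $(q_0,q_f)$ with $q_f\in Q_F$. -}

module Defs where

open import Data.Nat using (ℕ; zero; suc)
open import Data.Fin using (Fin; zero; suc)
open import Data.Bool using (Bool; true; false; not; T) renaming (_∧_ to _&&_; _∨_ to _||_)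
open import Data.Vec using (Vec; lookup; tabulate)
open import Data.List using (List; []; _∷_; _++_; map)
open import Data.Sum using (_⊎_; inj₁; inj₂)
open import Data.Product using (_×_)
open import Relation.Binary.PropositionalEquality using (_≡_; _≢_)
open import Function using (_∘_)

-- ○ = refuter, □ = prover
data Owner : Set where
  refuter prover : Owner

Sym : ℕ → ℕ → Set
Sym k t = Fin k ⊎ Fin t

record Grammar (k t : ℕ) : Set where
  field
    owner   : Fin k → Owner
    rhs     : Fin k → List (List (Sym k t))
    hasRule : (X : Fin k) → rhs X ≢ []

record NFA (t n : ℕ) : Set where
  field
    q₀    : Fin n
    final : Fin n → Bool
    δ     : Fin n → Fin t → Fin n → Bool

-- Boxes: subsets of Q × Q, as Boolean matrices

Box : ℕ → Set
Box n = Vec (Vec Bool n) n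

entry : ∀ {n} → Box n → Fin n → Fin n → Bool
entry ρ q q' = lookup (lookup ρ q) q'

anyFin : ∀ {n} → (Fin n → Bool) → Bool
anyFin {zero}  f = false
anyFin {suc n} f = f zero || anyFin (f ∘ suc)

_⨾ᵇ_ : ∀ {n} → Box n → Box n → Box n
ρ ⨾ᵇ τ = tabulate λ q → tabulate λ q'' → anyFin λ q' → entry ρ q q' && entry τ q' q''

idBox : ∀ {n} → Box n
idBox = tabulate λ q → tabulate λ q' → isEq q q'
  where
  isEq : ∀ {m} → Fin m → Fin m → Bool
  isEq zero    zero    = true
  isEq zero    (suc _) = false
  isEq (suc _) zero    = false
  isEq (suc a) (suc b) = isEq a b

termBox : ∀ {t n} → NFA t n → Fin t → Box n
termBox A a = tabulate λ q → tabulate λ q' → NFA.δ A q a q'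

data Form (n : ℕ) : Set where
  ff  : Form n
  bx  : Box n → Form n
  _⋀_ : Form n → Form n → Form n
  _⋁_ : Form n → Form n → Form n

_∧ₛ_ : ∀ {n} → Form n → Form n → Form n
ff ∧ₛ G  = ff
bx ρ ∧ₛ ff = ff
(F₁ ⋀ F₂) ∧ₛ ff = ff
(F₁ ⋁ F₂) ∧ₛ ff = ff
F ∧ₛ G = F ⋀ G

_∨ₛ_ : ∀ {n} → Form n → Form n → Form n
ff ∨ₛ G  = G
bx ρ ∨ₛ ff = bx ρ
(F₁ ⋀ F₂) ∨ₛ ff = F₁ ⋀ F₂
(F₁ ⋁ F₂) ∨ₛ ff = F₁ ⋁ F₂
F ∨ₛ G = F ⋁ G

_⨾_ : ∀ {n} → Form n → Form n → Form n
ff        ⨾ G = ff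
(F₁ ⋀ F₂) ⨾ G = (F₁ ⨾ G) ∧ₛ (F₂ ⨾ G)
(F₁ ⋁ F₂) ⨾ G = (F₁ ⨾ G) ∨ₛ (F₂ ⨾ G)
bx ρ ⨾ ff        = ff
bx ρ ⨾ bx τ      = bx (ρ ⨾ᵇ τ)
bx ρ ⨾ (G₁ ⋀ G₂) = (bx ρ ⨾ G₁) ∧ₛ (bx ρ ⨾ G₂)
bx ρ ⨾ (G₁ ⋁ G₂) = (bx ρ ⨾ G₁) ∨ₛ (bx ρ ⨾ G₂)

⟦_⟧ : ∀ {n} → Form n → (Box n → Bool) → Bool
⟦ ff ⟧    v = false
⟦ bx ρ ⟧  v = v ρ
⟦ F ⋀ G ⟧ v = ⟦ F ⟧ v && ⟦ G ⟧ v
⟦ F ⋁ G ⟧ v = ⟦ F ⟧ v || ⟦ G ⟧ v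

-- implication order and logical equivalence (formulas are taken modulo ≅)
_⊑_ : ∀ {n} → Form n → Form n → Set
F ⊑ G = ∀ v → T (⟦ F ⟧ v) → T (⟦ G ⟧ v)

_≅_ : ∀ {n} → Form n → Form n → Set
F ≅ G = (F ⊑ G) × (G ⊑ F)

rejVal : ∀ {t n} → NFA t n → Box n → Bool
rejVal A ρ = not (anyFin λ qf → NFA.final A qf && entry ρ (NFA.q₀ A) qf)

Rejecting : ∀ {t n} → NFA t n → Form n → Set
Rejecting A F = T (⟦ F ⟧ (rejVal A))

Assignment : ℕ → ℕ → Set
Assignment k n = Fin k → Form n

bigAnd bigOr : ∀ {n} → List (Form n) → Form n
bigAnd []           = ff   -- never used: every non-terminal has a rule
bigAnd (F ∷ [])     = F
bigAnd (F ∷ G ∷ Fs) = F ∧ₛ bigAnd (G ∷ Fs)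
bigOr []            = ff
bigOr (F ∷ [])      = F
bigOr (F ∷ G ∷ Fs)  = F ∨ₛ bigOr (G ∷ Fs)

module _ {k t n : ℕ} (A : NFA t n) (s : Assignment k n) where

  symF : Sym k t → Form n
  symF (inj₁ Y) = s Y
  symF (inj₂ a) = bx (termBox A a)

  wordF : List (Sym k t) → Form n
  wordF []      = bx idBox
  wordF (x ∷ α) = symF x ⨾ wordF α

Δ : ∀ {k t n} → Grammar k t → NFA t n → Assignment k n → Fin k → Form n
Δ G A s X with Grammar.owner G X
... | prover  = bigAnd (map (wordF A s) (Grammar.rhs G X))
... | refuter = bigOr  (map (wordF A s) (Grammar.rhs G X))

IsSolution : ∀ {k t n} → Grammar k t → NFA t n → Assignment k n → Set
IsSolution G A s = ∀ X → s X ≅ Δ G A s X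

IsLeastSolution : ∀ {k t n} → Grammar k t → NFA t n → Assignment k n → Set
IsLeastSolution G A σ =
  IsSolution G A σ × (∀ τ → IsSolution G A τ → ∀ X → σ X ⊑ τ X)

termWord : ∀ {k t} → List (Fin t) → List (Sym k t)
termWord = map inj₂

-- Truth values of formulas are computed compositionally: F ; G holds under an
-- assignment v iff F holds under ρ ↦ (G holds under τ ↦ v (ρ ; τ)), and as box
-- composition is associative with unit id, σ(α β) evaluates in the same way.
-- Because w is a terminal word, σ(w) is a single box, so σ(w X β) and σ(w η β)
-- are σ(X) and σ(η) evaluated under one and the same assignment u. Since σ is a
-- solution, σ(X) is equivalent to Δ_X, a conjunction (prover) or disjunction
-- (refuter) of the σ(η); if Δ_X is false under u, then some conjunct,
-- respectively every disjunct, is false under u.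
module Submission where

open import Defs
open import Data.Nat using (ℕ; zero; suc)
open import Data.Fin using (Fin; zero; suc)
open import Data.Bool using (Bool; true; false; T) renaming (_∧_ to _&&_; _∨_ to _||_)
open import Data.Bool.Properties using (T-∧; T-∨; T?; ∧-zeroʳ; ∨-identityʳ)
open import Data.Vec using (lookup; tabulate)
open import Data.Vec.Properties using (lookup∘tabulate; tabulate∘lookup; tabulate-cong)
open import Data.List using (List; []; _∷_; _++_; map; foldr)
open import Data.List.Membership.Propositional using (_∈_; find)
open import Data.List.Relation.Unary.Any using (here; there)
open import Data.List.Relation.Unary.All using (All; []; _∷_)
open import Data.List.Relation.Unary.All.Properties using (¬All⇒Any¬)
open import Data.Sum using (inj₁; inj₂)
open import Data.Unit using (tt)
open import Data.Empty using (⊥-elim)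
open import Data.Product using (Σ; _×_; _,_; proj₂; ∃; ∃-syntax)
open import Function using (_∘_; _⇔_; mk⇔; Equivalence)
open import Relation.Nullary using (¬_)
open import Relation.Binary.PropositionalEquality
  using (_≡_; _≢_; refl; sym; trans; cong; cong₂; subst; module ≡-Reasoning)

open Equivalence using (to; from)

T-⇔⇒≡ : ∀ {x y} → T x ⇔ T y → x ≡ y
T-⇔⇒≡ {false} {false} _ = refl
T-⇔⇒≡ {false} {true}  e = ⊥-elim (from e tt)
T-⇔⇒≡ {true}  {false} e = ⊥-elim (to e tt)
T-⇔⇒≡ {true}  {true}  _ = refl

T-anyFin : ∀ {n} (f : Fin n → Bool) → T (anyFin f) ⇔ ∃ λ i → T (f i)
T-anyFin {zero}  f = mk⇔ (λ ()) (λ ())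
T-anyFin {suc n} f = mk⇔ anyFin⇒∃ ∃⇒anyFin
  where
  anyFin⇒∃ : T (anyFin f) → ∃ λ i → T (f i)
  anyFin⇒∃ h with to T-∨ h
  ... | inj₁ h₀ = zero , h₀
  ... | inj₂ hₛ with to (T-anyFin (f ∘ suc)) hₛ
  ...   | i , hᵢ = suc i , hᵢ

  ∃⇒anyFin : (∃ λ i → T (f i)) → T (anyFin f)
  ∃⇒anyFin (zero  , h) = from T-∨ (inj₁ h)
  ∃⇒anyFin (suc i , h) = from T-∨ (inj₂ (from (T-anyFin (f ∘ suc)) (i , h)))

entry-tabulate : ∀ {n} (f : Fin n → Fin n → Bool) q q' →
                 entry (tabulate λ a → tabulate (f a)) q q' ≡ f q q'
entry-tabulate f q q' =
  trans (cong (λ r → lookup r q') (lookup∘tabulate _ q)) (lookup∘tabulate (f q) q')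

box-η : ∀ {n} (ρ : Box n) → ρ ≡ tabulate λ q → tabulate (entry ρ q)
box-η ρ = sym (trans (tabulate-cong (tabulate∘lookup ∘ lookup ρ)) (tabulate∘lookup ρ))

box-ext : ∀ {n} {ρ τ : Box n} → (∀ q q' → T (entry ρ q q') ⇔ T (entry τ q q')) → ρ ≡ τ
box-ext {ρ = ρ} {τ} p = begin
  ρ                                     ≡⟨ box-η ρ ⟩
  tabulate (λ q → tabulate (entry ρ q)) ≡⟨ tabulate-cong (λ q → tabulate-cong (T-⇔⇒≡ ∘ p q)) ⟩
  tabulate (λ q → tabulate (entry τ q)) ≡⟨ sym (box-η τ) ⟩
  τ                                     ∎
  where open ≡-Reasoning

T-entry-⨾ᵇ : ∀ {n} (ρ τ : Box n) q q'' →
             T (entry (ρ ⨾ᵇ τ) q q'') ⇔ ∃ λ q' → T (entry ρ q q') × T (entry τ q' q'')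
T-entry-⨾ᵇ ρ τ q q'' rewrite entry-tabulate (λ a b → anyFin λ q' → entry ρ a q' && entry τ q' b) q q'' =
  mk⇔ (λ h → let q' , h' = to (T-anyFin _) h in q' , to T-∧ h')
      (λ (q' , h') → from (T-anyFin _) (q' , from T-∧ h'))

⨾ᵇ-assoc : ∀ {n} (ρ τ μ : Box n) → (ρ ⨾ᵇ τ) ⨾ᵇ μ ≡ ρ ⨾ᵇ (τ ⨾ᵇ μ)
⨾ᵇ-assoc ρ τ μ = box-ext λ q r → mk⇔
  (λ h → let q₂ , h₁ , c = to (T-entry-⨾ᵇ (ρ ⨾ᵇ τ) μ q r) h
             q₁ , a , b  = to (T-entry-⨾ᵇ ρ τ q q₂) h₁
         in from (T-entry-⨾ᵇ ρ (τ ⨾ᵇ μ) q r) (q₁ , a , from (T-entry-⨾ᵇ τ μ q₁ r) (q₂ , b , c)))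
  (λ h → let q₁ , a , h₂ = to (T-entry-⨾ᵇ ρ (τ ⨾ᵇ μ) q r) h
             q₂ , b , c  = to (T-entry-⨾ᵇ τ μ q₁ r) h₂
         in from (T-entry-⨾ᵇ (ρ ⨾ᵇ τ) μ q r) (q₂ , from (T-entry-⨾ᵇ ρ τ q q₂) (q₁ , a , b) , c))

-- The entries of idBox are given by a function local to its definition; this names it.
idBox-entries : Σ (∀ {n} → Fin n → Fin n → Bool) λ isId →
                ∀ {n} (q q' : Fin n) → entry (idBox {n}) q q' ≡ isId q q'
idBox-entries = _ , λ q q' → entry-tabulate _ q q'

entry-idBox-suc : ∀ {n} (q q' : Fin n) → entry (idBox {suc n}) (suc q) (suc q') ≡ entry idBox q q'
entry-idBox-suc q q' = trans (proj₂ idBox-entries (suc q) (suc q')) (sym (proj₂ idBox-entries q q'))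

idBox-refl : ∀ {n} (q : Fin n) → T (entry idBox q q)
idBox-refl {suc n} zero = subst T (sym (proj₂ idBox-entries {suc n} zero zero)) tt
idBox-refl (suc q)      = subst T (sym (entry-idBox-suc q q)) (idBox-refl q)

idBox⇒≡ : ∀ {n} {q q' : Fin n} → T (entry idBox q q') → q ≡ q'
idBox⇒≡ {q = zero}  {zero}   _ = refl
idBox⇒≡ {q = zero}  {suc q'} h = ⊥-elim (subst T (proj₂ idBox-entries zero (suc q')) h)
idBox⇒≡ {q = suc q} {zero}   h = ⊥-elim (subst T (proj₂ idBox-entries (suc q) zero) h)
idBox⇒≡ {q = suc q} {suc q'} h = cong suc (idBox⇒≡ (subst T (entry-idBox-suc q q') h))

idBox-⨾ᵇ : ∀ {n} (τ : Box n) → idBox ⨾ᵇ τ ≡ τ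
idBox-⨾ᵇ τ = box-ext λ q r → mk⇔
  (λ h → let q' , q≡q' , h' = to (T-entry-⨾ᵇ idBox τ q r) h
         in subst (λ x → T (entry τ x r)) (sym (idBox⇒≡ q≡q')) h')
  (λ h → from (T-entry-⨾ᵇ idBox τ q r) (q , idBox-refl q , h))

⟦∧ₛ⟧ : ∀ {n} (F G : Form n) v → ⟦ F ∧ₛ G ⟧ v ≡ (⟦ F ⟧ v && ⟦ G ⟧ v)
⟦∧ₛ⟧ ff        _         _ = refl
⟦∧ₛ⟧ (bx _)    ff        v = sym (∧-zeroʳ _)
⟦∧ₛ⟧ (_ ⋀ _)   ff        v = sym (∧-zeroʳ _)
⟦∧ₛ⟧ (_ ⋁ _)   ff        v = sym (∧-zeroʳ _)
⟦∧ₛ⟧ (bx _)    (bx _)    _ = refl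
⟦∧ₛ⟧ (bx _)    (_ ⋀ _)   _ = refl
⟦∧ₛ⟧ (bx _)    (_ ⋁ _)   _ = refl
⟦∧ₛ⟧ (_ ⋀ _)   (bx _)    _ = refl
⟦∧ₛ⟧ (_ ⋀ _)   (_ ⋀ _)   _ = refl
⟦∧ₛ⟧ (_ ⋀ _)   (_ ⋁ _)   _ = refl
⟦∧ₛ⟧ (_ ⋁ _)   (bx _)    _ = refl
⟦∧ₛ⟧ (_ ⋁ _)   (_ ⋀ _)   _ = refl
⟦∧ₛ⟧ (_ ⋁ _)   (_ ⋁ _)   _ = refl

⟦∨ₛ⟧ : ∀ {n} (F G : Form n) v → ⟦ F ∨ₛ G ⟧ v ≡ (⟦ F ⟧ v || ⟦ G ⟧ v)
⟦∨ₛ⟧ ff        _         _ = refl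
⟦∨ₛ⟧ (bx _)    ff        v = sym (∨-identityʳ _)
⟦∨ₛ⟧ (_ ⋀ _)   ff        v = sym (∨-identityʳ _)
⟦∨ₛ⟧ (_ ⋁ _)   ff        v = sym (∨-identityʳ _)
⟦∨ₛ⟧ (bx _)    (bx _)    _ = refl
⟦∨ₛ⟧ (bx _)    (_ ⋀ _)   _ = refl
⟦∨ₛ⟧ (bx _)    (_ ⋁ _)   _ = refl
⟦∨ₛ⟧ (_ ⋀ _)   (bx _)    _ = refl
⟦∨ₛ⟧ (_ ⋀ _)   (_ ⋀ _)   _ = refl
⟦∨ₛ⟧ (_ ⋀ _)   (_ ⋁ _)   _ = refl
⟦∨ₛ⟧ (_ ⋁ _)   (bx _)    _ = refl
⟦∨ₛ⟧ (_ ⋁ _)   (_ ⋀ _)   _ = refl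
⟦∨ₛ⟧ (_ ⋁ _)   (_ ⋁ _)   _ = refl

⟦⟧-cong : ∀ {n} (F : Form n) {u u' : Box n → Bool} → (∀ ρ → u ρ ≡ u' ρ) → ⟦ F ⟧ u ≡ ⟦ F ⟧ u'
⟦⟧-cong ff      p = refl
⟦⟧-cong (bx ρ)  p = p ρ
⟦⟧-cong (F ⋀ G) p = cong₂ _&&_ (⟦⟧-cong F p) (⟦⟧-cong G p)
⟦⟧-cong (F ⋁ G) p = cong₂ _||_ (⟦⟧-cong F p) (⟦⟧-cong G p)

after : ∀ {n} → Form n → (Box n → Bool) → Box n → Bool
after G v ρ = ⟦ G ⟧ (v ∘ (ρ ⨾ᵇ_))

⟦bx⨾⟧ : ∀ {n} (ρ : Box n) (G : Form n) v → ⟦ bx ρ ⨾ G ⟧ v ≡ after G v ρ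
⟦bx⨾⟧ ρ ff        v = refl
⟦bx⨾⟧ ρ (bx τ)    v = refl
⟦bx⨾⟧ ρ (G₁ ⋀ G₂) v =
  trans (⟦∧ₛ⟧ (bx ρ ⨾ G₁) _ v) (cong₂ _&&_ (⟦bx⨾⟧ ρ G₁ v) (⟦bx⨾⟧ ρ G₂ v))
⟦bx⨾⟧ ρ (G₁ ⋁ G₂) v =
  trans (⟦∨ₛ⟧ (bx ρ ⨾ G₁) _ v) (cong₂ _||_ (⟦bx⨾⟧ ρ G₁ v) (⟦bx⨾⟧ ρ G₂ v))

⟦⨾⟧ : ∀ {n} (F G : Form n) v → ⟦ F ⨾ G ⟧ v ≡ ⟦ F ⟧ (after G v)
⟦⨾⟧ ff        G v = refl
⟦⨾⟧ (bx ρ)    G v = ⟦bx⨾⟧ ρ G v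
⟦⨾⟧ (F₁ ⋀ F₂) G v = trans (⟦∧ₛ⟧ (F₁ ⨾ G) _ v) (cong₂ _&&_ (⟦⨾⟧ F₁ G v) (⟦⨾⟧ F₂ G v))
⟦⨾⟧ (F₁ ⋁ F₂) G v = trans (⟦∨ₛ⟧ (F₁ ⨾ G) _ v) (cong₂ _||_ (⟦⨾⟧ F₁ G v) (⟦⨾⟧ F₂ G v))

after-⨾ᵇ : ∀ {n} (G : Form n) v (ρ τ : Box n) → after G (v ∘ (ρ ⨾ᵇ_)) τ ≡ after G v (ρ ⨾ᵇ τ)
after-⨾ᵇ G v ρ τ = ⟦⟧-cong G λ μ → cong v (sym (⨾ᵇ-assoc ρ τ μ))

bigAnd-intro : ∀ {n} {S : Set} (f : S → Form n) v (Ss : List S) → Ss ≢ [] →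
               All (λ η → T (⟦ f η ⟧ v)) Ss → T (⟦ bigAnd (map f Ss) ⟧ v)
bigAnd-intro f v []           ne _        = ⊥-elim (ne refl)
bigAnd-intro f v (_ ∷ [])     _  (h ∷ []) = h
bigAnd-intro f v (η ∷ ζ ∷ Ss) _  (h ∷ hs) =
  subst T (sym (⟦∧ₛ⟧ (f η) _ v)) (from T-∧ (h , bigAnd-intro f v (ζ ∷ Ss) (λ ()) hs))

bigOr-intro : ∀ {n} {S : Set} (f : S → Form n) v {η} (Ss : List S) →
              η ∈ Ss → T (⟦ f η ⟧ v) → T (⟦ bigOr (map f Ss) ⟧ v)
bigOr-intro f v (_ ∷ [])     (here refl) h = h
bigOr-intro f v (η ∷ ζ ∷ Ss) (here refl) h = subst T (sym (⟦∨ₛ⟧ (f η) _ v)) (from T-∨ (inj₁ h))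
bigOr-intro f v (η ∷ ζ ∷ Ss) (there η∈)  h =
  subst T (sym (⟦∨ₛ⟧ (f η) _ v)) (from T-∨ (inj₂ (bigOr-intro f v (ζ ∷ Ss) η∈ h)))

module _ {k t n : ℕ} (A : NFA t n) (s : Assignment k n) where

  wordBox : List (Fin t) → Box n
  wordBox = foldr (λ a ρ → termBox A a ⨾ᵇ ρ) idBox

  wordF-termWord : ∀ w → wordF A s (termWord w) ≡ bx (wordBox w)
  wordF-termWord []      = refl
  wordF-termWord (a ∷ w) = cong (bx (termBox A a) ⨾_) (wordF-termWord w)

  ⟦wordF-++⟧ : ∀ α γ v → ⟦ wordF A s (α ++ γ) ⟧ v ≡ ⟦ wordF A s α ⟧ (after (wordF A s γ) v)
  ⟦wordF-++⟧ []      γ v = ⟦⟧-cong (wordF A s γ) λ τ → cong v (sym (idBox-⨾ᵇ τ))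
  ⟦wordF-++⟧ (x ∷ α) γ v = begin
    ⟦ symF A s x ⨾ wordF A s (α ++ γ) ⟧ v            ≡⟨ ⟦⨾⟧ (symF A s x) _ v ⟩
    ⟦ symF A s x ⟧ (after (wordF A s (α ++ γ)) v)     ≡⟨ ⟦⟧-cong (symF A s x) reassociate ⟩
    ⟦ symF A s x ⟧ (after (wordF A s α) (after γ′ v)) ≡⟨ sym (⟦⨾⟧ (symF A s x) _ _) ⟩
    ⟦ symF A s x ⨾ wordF A s α ⟧ (after γ′ v)         ∎
    where
    open ≡-Reasoning
    γ′ : Form n
    γ′ = wordF A s γ
    reassociate : ∀ ρ → after (wordF A s (α ++ γ)) v ρ ≡ after (wordF A s α) (after γ′ v) ρ
    reassociate ρ = trans (⟦wordF-++⟧ α γ (v ∘ (ρ ⨾ᵇ_))) (⟦⟧-cong (wordF A s α) (after-⨾ᵇ γ′ v ρ))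

  context : List (Fin t) → List (Sym k t) → (Box n → Bool) → Box n → Bool
  context w β v = after (wordF A s β) (v ∘ (wordBox w ⨾ᵇ_))

  ⟦wordF-termWord-++⟧ : ∀ w γ v → ⟦ wordF A s (termWord w ++ γ) ⟧ v ≡ ⟦ wordF A s γ ⟧ (v ∘ (wordBox w ⨾ᵇ_))
  ⟦wordF-termWord-++⟧ w γ v =
    trans (⟦wordF-++⟧ (termWord w) γ v) (cong (λ F → ⟦ F ⟧ (after (wordF A s γ) v)) (wordF-termWord w))

  ⟦wordF-plug-nonterminal⟧ : ∀ w X β v →
    ⟦ wordF A s (termWord w ++ inj₁ X ∷ β) ⟧ v ≡ ⟦ s X ⟧ (context w β v)
  ⟦wordF-plug-nonterminal⟧ w X β v =
    trans (⟦wordF-termWord-++⟧ w (inj₁ X ∷ β) v) (⟦⨾⟧ (s X) (wordF A s β) _)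

  ⟦wordF-plug⟧ : ∀ w η β v → ⟦ wordF A s (termWord w ++ η ++ β) ⟧ v ≡ ⟦ wordF A s η ⟧ (context w β v)
  ⟦wordF-plug⟧ w η β v = trans (⟦wordF-termWord-++⟧ w (η ++ β) v) (⟦wordF-++⟧ η β _)

module _ {k t n : ℕ} (G : Grammar k t) (A : NFA t n) (s : Assignment k n) (X : Fin k) where
  open Grammar G

  Δ-prover-intro : owner X ≡ prover → ∀ v →
                   All (λ η → T (⟦ wordF A s η ⟧ v)) (rhs X) → T (⟦ Δ G A s X ⟧ v)
  Δ-prover-intro e v with owner X
  Δ-prover-intro refl v | prover = bigAnd-intro (wordF A s) v (rhs X) (hasRule X)

  Δ-refuter-intro : owner X ≡ refuter → ∀ v {η} →
                    η ∈ rhs X → T (⟦ wordF A s η ⟧ v) → T (⟦ Δ G A s X ⟧ v)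
  Δ-refuter-intro e v with owner X
  Δ-refuter-intro refl v | refuter = bigOr-intro (wordF A s) v (rhs X)

lemma23 : ∀ {k t n} (G : Grammar k t) (A : NFA t n) (σ : Assignment k n)
    → IsLeastSolution G A σ
    → (w : List (Fin t)) (X : Fin k) (β : List (Sym k t))
    → ¬ Rejecting A (wordF A σ (termWord w ++ inj₁ X ∷ β))
    → (Grammar.owner G X ≡ prover
        → ∃[ η ] (η ∈ Grammar.rhs G X × ¬ Rejecting A (wordF A σ (termWord w ++ η ++ β))))
      × (Grammar.owner G X ≡ refuter
        → ∀ η → η ∈ Grammar.rhs G X → ¬ Rejecting A (wordF A σ (termWord w ++ η ++ β)))
lemma23 {n = n} G A σ (σ-solution , _) w X β X-accepted = prover-case , refuter-case
  where
  open Grammar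

  u : Box n → Bool
  u = context A σ w β (rejVal A)

  Δ-false : ¬ T (⟦ Δ G A σ X ⟧ u)
  Δ-false h = X-accepted (subst T (sym (⟦wordF-plug-nonterminal⟧ A σ w X β _)) (proj₂ (σ-solution X) u h))

  plug-accepted : ∀ η → ¬ T (⟦ wordF A σ η ⟧ u) → ¬ Rejecting A (wordF A σ (termWord w ++ η ++ β))
  plug-accepted η h r = h (subst T (⟦wordF-plug⟧ A σ w η β _) r)

  prover-case : owner G X ≡ prover →
                ∃[ η ] (η ∈ rhs G X × ¬ Rejecting A (wordF A σ (termWord w ++ η ++ β)))
  prover-case e =
    let η , η∈ , h = find (¬All⇒Any¬ (λ η → T? _) _ (Δ-false ∘ Δ-prover-intro G A σ X e u))
    in η , η∈ , plug-accepted η h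

  refuter-case : owner G X ≡ refuter →
                 ∀ η → η ∈ rhs G X → ¬ Rejecting A (wordF A σ (termWord w ++ η ++ β))
  refuter-case e η η∈ = plug-accepted η (Δ-false ∘ Δ-refuter-intro G A σ X e u η∈)
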